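{- Let $F$ be a forest (a simple graph without cycles). Then $\mathrm{ex}^u_e(F,n)\ll n$.
   Context: A hypergraph $H=(E_i:i\in I)$ is a finite list of finite nonempty subsets of $\mathbb{N}$; it is simple if its edges are pairwise distinct; $v(H)=|\bigcup_iE_i|$, $e(H)=|I|$. In the unordered sense, $H$ contains $H'=(E'_i:i\in I')$ if there exist an injection (not necessarily increasing) $\phi:\bigcup H'\to\bigcup H$ and an injection $f:I'\to I$ with $v\in E'_i\Rightarrow\phi(v)\in E_{f(i)}$. $\mathrm{ex}^u_e(F,n)$ is the maximum of $e(H)$ over simple hypergraphs $H$ with $v(H)\le n$ not containing $F$ in the unordered sense. $f\ll g$ means $|f(n)|<c|g(n)|$ for a constant $c>0$ and all large $n$. -}

module Defs where

open import Data.Nat using (ℕ; _≤_)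
open import Data.Nat.Properties using (_≟_)
open import Data.List using (List; []; _∷_; length; concat; deduplicate; lookup)
open import Data.List.Membership.Propositional using (_∈_)
open import Data.List.Relation.Unary.All using (All)
open import Data.List.Relation.Unary.AllPairs using (AllPairs)
open import Data.List.Relation.Unary.Unique.Propositional using (Unique)
open import Data.Fin using (Fin)
open import Data.Product using (Σ; ∃; _×_; _,_)
open import Data.Empty using (⊥)
open import Relation.Nullary using (¬_)
open import Relation.Binary.PropositionalEquality using (_≡_; _≢_)
open import Function.Definitions using (Injective)

-- A hypergraph is a finite list of edges; an edge is a finite subset of ℕ,
-- represented by a list of naturals (read as the set of its entries).
Edge : Set
Edge = List ℕ

Hypergraph : Set
Hypergraph = List Edge

IsHypergraph : Hypergraph → Set
IsHypergraph H = All (λ E → E ≢ []) H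

_≐_ : Edge → Edge → Set
E ≐ E' = ∀ x → (x ∈ E → x ∈ E') × (x ∈ E' → x ∈ E)

Simple : Hypergraph → Set
Simple H = AllPairs (λ E E' → ¬ (E ≐ E')) H

vertices : Hypergraph → List ℕ
vertices H = concat H

v : Hypergraph → ℕ
v H = length (deduplicate _≟_ (vertices H))

e : Hypergraph → ℕ
e H = length H

-- H contains H' in the unordered sense: an injection φ : ⋃ H' → ⋃ H and an
-- injection f on edge indices with v ∈ E'_i ⇒ φ v ∈ E_{f i}.
Contains : Hypergraph → Hypergraph → Set
Contains H H' =
  Σ (ℕ → ℕ) λ φ →
  Σ (Fin (length H') → Fin (length H)) λ f →
    (∀ x y → x ∈ vertices H' → y ∈ vertices H' → φ x ≡ φ y → x ≡ y)
  × (∀ x → x ∈ vertices H' → φ x ∈ vertices H)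
  × Injective _≡_ _≡_ f
  × (∀ i x → x ∈ lookup H' i → φ x ∈ lookup H (f i))

IsTwoSet : Edge → Set
IsTwoSet E = Σ ℕ λ x → Σ ℕ λ y → (x ≢ y) × (E ≡ x ∷ y ∷ [])

IsSimpleGraph : Hypergraph → Set
IsSimpleGraph G = All IsTwoSet G × Simple G

Adjacent : Hypergraph → ℕ → ℕ → Set
Adjacent G x y = Σ Edge λ E → (E ∈ G) × (x ∈ E) × (y ∈ E) × (x ≢ y)

CycAdj : Hypergraph → ℕ → List ℕ → Set
CycAdj G first []           = ⊥
CycAdj G first (x ∷ [])     = Adjacent G x first
CycAdj G first (x ∷ y ∷ zs) = Adjacent G x y × CycAdj G first (y ∷ zs)

IsCycle : Hypergraph → List ℕ → Set
IsCycle G []                 = ⊥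
IsCycle G (x ∷ [])           = ⊥
IsCycle G (x ∷ y ∷ [])       = ⊥
IsCycle G (x ∷ y ∷ z ∷ ws)   = Unique (x ∷ y ∷ z ∷ ws) × CycAdj G x (x ∷ y ∷ z ∷ ws)

IsForest : Hypergraph → Set
IsForest F = IsSimpleGraph F × (∀ C → ¬ IsCycle F C)

{-# OPTIONS --safe #-}
-- Let T bound the number of vertices and K the number of edges of the forest F, and C = 2 ^ T + K.  Such an edge exists because the edges through a vertex are pairwise distinct sets,
-- so at most 2 ^ T of them lie inside the image, and at most K are used.  Hence an F-free simple H has a
-- vertex of degree at most C; deleting it with its edges and inducting on the number of vertices gives
-- e(H) ≤ C · v(H).
module Submission where

open import Defs
open import Level using (Level)
open import Function using (_∘_)
open import Function.Definitions using (Injective)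
open import Data.Nat using (ℕ; zero; suc; pred; _≤_; _<_; _*_; _+_; _^_; z≤n; s≤s)
open import Data.Nat.Properties
open import Data.Product using (∃; _×_; _,_; proj₁; proj₂; swap)
open import Data.Sum using (_⊎_; inj₁; inj₂)
open import Data.Fin using (Fin; zero; suc; toℕ)
import Data.Fin.Properties as FinP
open import Data.List using (List; []; _∷_; _++_; length; concat; filter; lookup; removeAt; map; tabulate; take)
open import Data.List.Properties
  using (filter-all; filter-notAll; length-map; length-tabulate; length-++; length-removeAt; ≡-dec)
open import Data.List.Membership.Propositional using (_∈_; _∉_; find; lose)
open import Data.List.Membership.Propositional.Properties
open import Data.List.Membership.DecPropositional _≟_ using (_∈?_; _∉?_)
open import Data.List.Membership.DecPropositional (≡-dec _≟_) using () renaming (_∈?_ to _∈ₑ?_)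
open import Data.List.Relation.Binary.Subset.DecPropositional _≟_ using (_⊆?_)
open import Data.List.Relation.Binary.Subset.Propositional using (_⊆_)
open import Data.List.Relation.Binary.Permutation.Propositional using (_↭_; ↭-refl; ↭-trans)
open import Data.List.Relation.Binary.Permutation.Propositional.Properties
  using (++⁺ˡ; shifts; ↭-length; ∈-resp-↭)
open import Data.List.Relation.Unary.Any as Any using (Any; here; there)
open import Data.List.Relation.Unary.All as All using (All; []; _∷_)
import Data.List.Relation.Unary.All.Properties as AllP
open import Data.List.Relation.Unary.All.Properties.Core using (¬All⇒Any¬)
open import Data.List.Relation.Unary.Any.Properties using (lookup-index)
open import Data.List.Relation.Unary.AllPairs using (AllPairs; []; _∷_)
import Data.List.Relation.Unary.AllPairs.Properties as AP
import Data.List.Relation.Unary.AllPairs as AllPairs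
open import Data.List.Relation.Unary.Linked using (Linked; []; [-]; _∷_)
open import Data.List.Relation.Unary.Unique.Propositional using (Unique)
open import Relation.Nullary using (¬_; yes; no; contradiction)
open import Relation.Nullary.Decidable using (decidable-stable)
open import Relation.Unary using (Pred; Decidable; ∁)
open import Relation.Unary.Properties using (∁?; _∪?_)
open import Relation.Binary.Definitions using (Symmetric; DecidableEquality)
open import Relation.Binary.PropositionalEquality

private
  variable
    a b p q r : Level
    A : Set a

module _ {P : Pred A p} (P? : Decidable P) where

  length-filter-∁ : ∀ xs → length (filter P? xs) + length (filter (∁? P?) xs) ≡ length xs
  length-filter-∁ [] = refl
  length-filter-∁ (x ∷ xs) with P? x
  ... | yes _ = cong suc (length-filter-∁ xs)
  ... | no _  = trans (+-suc _ _) (cong suc (length-filter-∁ xs))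

  filter-shorter⇒Any∁ : ∀ {xs} → length (filter P? xs) < length xs → Any (∁ P) xs
  filter-shorter⇒Any∁ {xs} shorter with All.all? P? xs
  ... | yes all = contradiction (cong length (filter-all P? all)) (<⇒≢ shorter)
  ... | no ¬all = ¬All⇒Any¬ P? xs ¬all

  filterIndex : ∀ xs → Fin (length (filter P? xs)) → Fin (length xs)
  filterIndex (x ∷ xs) k with P? x
  filterIndex (x ∷ xs) zero    | yes _ = zero
  filterIndex (x ∷ xs) (suc k) | yes _ = suc (filterIndex xs k)
  filterIndex (x ∷ xs) k       | no _  = suc (filterIndex xs k)

  filterIndex-injective : ∀ xs → Injective _≡_ _≡_ (filterIndex xs)
  filterIndex-injective (x ∷ xs) {k} {k′} eq with P? x
  filterIndex-injective (x ∷ xs) {zero}  {zero}   eq | yes _ = refl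
  filterIndex-injective (x ∷ xs) {suc k} {suc k′} eq | yes _ =
    cong suc (filterIndex-injective xs (FinP.suc-injective eq))
  filterIndex-injective (x ∷ xs) {k} {k′} eq | no _ =
    filterIndex-injective xs (FinP.suc-injective eq)

  lookup-filter : ∀ xs k → lookup (filter P? xs) k ≡ lookup xs (filterIndex xs k)
  lookup-filter (x ∷ xs) k with P? x
  lookup-filter (x ∷ xs) zero    | yes _ = refl
  lookup-filter (x ∷ xs) (suc k) | yes _ = lookup-filter xs k
  lookup-filter (x ∷ xs) k       | no _  = lookup-filter xs k

  module _ {Q : Pred A q} (Q? : Decidable Q) where

    length-filter-∪ : ∀ xs → length (filter (P? ∪? Q?) xs) ≤ length (filter P? xs) + length (filter Q? xs)
    length-filter-∪ [] = z≤n
    length-filter-∪ (x ∷ xs) with ih ← length-filter-∪ xs | P? x | Q? x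
    ... | yes _ | yes _ = s≤s (≤-trans ih (+-monoʳ-≤ _ (n≤1+n _)))
    ... | yes _ | no _  = s≤s ih
    ... | no _  | yes _ = ≤-trans (s≤s ih) (≤-reflexive (sym (+-suc _ _)))
    ... | no _  | no _  = ih

Unique-⊆⇒length≤ : DecidableEquality A → ∀ {xs ys : List A} → Unique xs → xs ⊆ ys → length xs ≤ length ys
Unique-⊆⇒length≤ _≟_ {[]} _ _ = z≤n
Unique-⊆⇒length≤ _≟_ {x ∷ xs} {ys} (x∉xs ∷ unique) xs⊆ys =
  ≤-trans (s≤s (Unique-⊆⇒length≤ _≟_ unique xs⊆ys-x)) (filter-notAll (∁? (_≟ x)) ys x∈ys)
  where
  xs⊆ys-x : xs ⊆ filter (∁? (_≟ x)) ys
  xs⊆ys-x z∈xs = ∈-filter⁺ (∁? (_≟ x)) (xs⊆ys (there z∈xs)) (λ { refl → All.lookup x∉xs z∈xs refl })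
  x∈ys : Any (∁ (∁ (_≡ x))) ys
  x∈ys = Any.map (λ { refl x≢x → x≢x refl }) (xs⊆ys (here refl))

punchInAt : (xs : List A) (i : Fin (length xs)) → Fin (length (removeAt xs i)) → Fin (length xs)
punchInAt (x ∷ xs) zero    k       = suc k
punchInAt (x ∷ xs) (suc i) zero    = zero
punchInAt (x ∷ xs) (suc i) (suc k) = suc (punchInAt xs i k)

lookup-removeAt : ∀ (xs : List A) i k → lookup (removeAt xs i) k ≡ lookup xs (punchInAt xs i k)
lookup-removeAt (x ∷ xs) zero    k       = refl
lookup-removeAt (x ∷ xs) (suc i) zero    = refl
lookup-removeAt (x ∷ xs) (suc i) (suc k) = lookup-removeAt xs i k

data RemoveAtView (xs : List A) (i : Fin (length xs)) : Fin (length xs) → Set where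
  removed : RemoveAtView xs i i
  kept    : ∀ k → RemoveAtView xs i (punchInAt xs i k)

removeAtView : ∀ (xs : List A) i k → RemoveAtView xs i k
removeAtView (x ∷ xs) zero    zero    = removed
removeAtView (x ∷ xs) zero    (suc k) = kept k
removeAtView (x ∷ xs) (suc i) zero    = kept zero
removeAtView (x ∷ xs) (suc i) (suc k) with removeAtView xs i k
... | removed = removed
... | kept k′ = kept (suc k′)

∈-removeAt⁻ : ∀ {y} (xs : List A) i → y ∈ removeAt xs i → y ∈ xs
∈-removeAt⁻ (x ∷ xs) zero    y∈          = there y∈
∈-removeAt⁻ (x ∷ xs) (suc i) (here refl) = here refl
∈-removeAt⁻ (x ∷ xs) (suc i) (there y∈)  = there (∈-removeAt⁻ xs i y∈)

length-removeAt≤ : ∀ (xs : List A) i → length (removeAt xs i) ≤ length xs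
length-removeAt≤ xs i = ≤-trans (≤-reflexive (length-removeAt xs i)) pred[n]≤n

module _ {R : A → A → Set r} where

  AllPairs-removeAt⁺ : ∀ {xs} i → AllPairs R xs → AllPairs R (removeAt xs i)
  AllPairs-removeAt⁺ {x ∷ xs} zero    (_ ∷ pairs)   = pairs
  AllPairs-removeAt⁺ {x ∷ xs} (suc i) (rel ∷ pairs) =
    All.tabulate (All.lookup rel ∘ ∈-removeAt⁻ xs i) ∷ AllPairs-removeAt⁺ i pairs

  AllPairs-lookup-removeAt : Symmetric R → ∀ {xs y} i → AllPairs R xs → y ∈ removeAt xs i → R (lookup xs i) y
  AllPairs-lookup-removeAt R-sym {x ∷ xs} zero    (rel ∷ _)   y∈          = All.lookup rel y∈
  AllPairs-lookup-removeAt R-sym {x ∷ xs} (suc i) (rel ∷ _)   (here refl) = R-sym (All.lookup rel (∈-lookup i))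
  AllPairs-lookup-removeAt R-sym {x ∷ xs} (suc i) (_ ∷ pairs) (there y∈)  =
    AllPairs-lookup-removeAt R-sym i pairs y∈

concat-removeAt : ∀ (xss : List (List A)) i → concat xss ↭ lookup xss i ++ concat (removeAt xss i)
concat-removeAt (xs ∷ xss) zero    = ↭-refl
concat-removeAt (xs ∷ xss) (suc i) = ↭-trans (++⁺ˡ xs (concat-removeAt xss i)) (shifts xs (lookup xss i))

length-concat-removeAt : ∀ (xss : List (List A)) i →
                         length (concat xss) ≡ length (lookup xss i) + length (concat (removeAt xss i))
length-concat-removeAt xss i = trans (↭-length (concat-removeAt xss i)) (length-++ (lookup xss i))

module _ {B : Set b} (xs : List A) (i : Fin (length xs)) (f : Fin (length (removeAt xs i)) → B) (y : B) where

  extendAtView : ∀ {k} → RemoveAtView xs i k → B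
  extendAtView removed  = y
  extendAtView (kept k) = f k

  extendAt : Fin (length xs) → B
  extendAt k = extendAtView (removeAtView xs i k)

  extendAt-injective : Injective _≡_ _≡_ f → (∀ k → f k ≢ y) → Injective _≡_ _≡_ extendAt
  extendAt-injective f-inj y-fresh {k₁} {k₂} = injective (removeAtView xs i k₁) (removeAtView xs i k₂)
    where
    injective : ∀ {k₁ k₂} (v₁ : RemoveAtView xs i k₁) (v₂ : RemoveAtView xs i k₂) →
                extendAtView v₁ ≡ extendAtView v₂ → k₁ ≡ k₂
    injective removed   removed   _  = refl
    injective removed   (kept k)  eq = contradiction (sym eq) (y-fresh k)
    injective (kept k)  removed   eq = contradiction eq (y-fresh k)
    injective (kept k₁) (kept k₂) eq = cong (punchInAt xs i) (f-inj eq)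

InjectiveOn : (ℕ → ℕ) → List ℕ → Set
InjectiveOn φ A = ∀ x y → x ∈ A → y ∈ A → φ x ≡ φ y → x ≡ y

InjectiveOn-⊆ : ∀ {φ A B} → A ⊆ B → InjectiveOn φ B → InjectiveOn φ A
InjectiveOn-⊆ A⊆B inj x y x∈ y∈ = inj x y (A⊆B x∈) (A⊆B y∈)

_[_↦_] : (ℕ → ℕ) → ℕ → ℕ → ℕ → ℕ
(φ [ v ↦ w ]) z with z ≟ v
... | yes _ = w
... | no _  = φ z

[↦]-updated : ∀ φ v w → (φ [ v ↦ w ]) v ≡ w
[↦]-updated φ v w with v ≟ v
... | yes _   = refl
... | no v≢v = contradiction refl v≢v

[↦]-unchanged : ∀ φ {v w z} → z ≢ v → (φ [ v ↦ w ]) z ≡ φ z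
[↦]-unchanged φ {v} {z = z} z≢v with z ≟ v
... | yes z≡v = contradiction z≡v z≢v
... | no _    = refl

InjectiveOn-[↦] : ∀ {φ A v w} → InjectiveOn φ A → v ∉ A → w ∉ map φ A → InjectiveOn (φ [ v ↦ w ]) (v ∷ A)
InjectiveOn-[↦] {φ} {A} {v} {w} inj v∉A w∉φA = injective
  where
  unchanged : ∀ {z} → z ∈ A → (φ [ v ↦ w ]) z ≡ φ z
  unchanged z∈A = [↦]-unchanged φ (λ { refl → v∉A z∈A })
  w≢φ : ∀ {z} → z ∈ A → w ≢ (φ [ v ↦ w ]) z
  w≢φ z∈A w≡ = w∉φA (subst (_∈ map φ A) (sym (trans w≡ (unchanged z∈A))) (∈-map⁺ φ z∈A))
  injective : InjectiveOn (φ [ v ↦ w ]) (v ∷ A)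
  injective x y (here refl)  (here refl)  _  = refl
  injective x y (here refl)  (there y∈A) eq = contradiction (trans (sym ([↦]-updated φ v w)) eq) (w≢φ y∈A)
  injective x y (there x∈A) (here refl)  eq = contradiction (trans (sym ([↦]-updated φ v w)) (sym eq)) (w≢φ x∈A)
  injective x y (there x∈A) (there y∈A) eq =
    inj x y x∈A y∈A (trans (sym (unchanged x∈A)) (trans eq (unchanged y∈A)))

∈-vertices⁺ : ∀ G {x} i → x ∈ lookup G i → x ∈ vertices G
∈-vertices⁺ G i x∈ = ∈-concat⁺′ x∈ (∈-lookup {xs = G} i)

∈-vertices⁻ : ∀ G {x} → x ∈ vertices G → ∃ λ i → x ∈ lookup G i
∈-vertices⁻ G x∈ with E , x∈E , E∈G ← ∈-concat⁻′ G x∈ =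
  Any.index E∈G , subst (_ ∈_) (lookup-index E∈G) x∈E

edges⇒vertices : ∀ F H {φ : ℕ → ℕ} (f : Fin (length F) → Fin (length H)) →
                 (∀ i x → x ∈ lookup F i → φ x ∈ lookup H (f i)) → ∀ x → x ∈ vertices F → φ x ∈ vertices H
edges⇒vertices F H f edges x x∈ with i , x∈Fi ← ∈-vertices⁻ F x∈ = ∈-vertices⁺ H (f i) (edges i x x∈Fi)

Contains-[] : ∀ H → Contains H []
Contains-[] H = (λ x → x) , (λ ()) , (λ _ _ ()) , (λ _ ()) , (λ { {()} }) , (λ ())

Contains-filter⁻ : ∀ {P : Pred Edge p} (P? : Decidable P) H {F} → Contains (filter P? H) F → Contains H F
Contains-filter⁻ P? H {F} (φ , f , φ-inj , _ , f-inj , φ-edges) =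
  φ , filterIndex P? H ∘ f , φ-inj , edges⇒vertices F H (filterIndex P? H ∘ f) edges ,
  f-inj ∘ filterIndex-injective P? H , edges
  where
  edges : ∀ i x → x ∈ _ → φ x ∈ lookup H (filterIndex P? H (f i))
  edges i x x∈ = subst (φ x ∈_) (lookup-filter P? H (f i)) (φ-edges i x x∈)

-- Counting edges of simple hypergraphs

without : ℕ → Edge → Edge
without s = filter (∁? (_≟ s))

≐-without⁻ : ∀ {s E E′} → s ∈ E → s ∈ E′ → without s E ≐ without s E′ → E ≐ E′
≐-without⁻ {s} {E} {E′} s∈E s∈E′ eq x =
  transport E E′ s∈E′ (proj₁ (eq x)) , transport E′ E s∈E (proj₂ (eq x))
  where
  transport : ∀ A B → s ∈ B → (x ∈ without s A → x ∈ without s B) → x ∈ A → x ∈ B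
  transport A B s∈B to x∈A with x ≟ s
  ... | yes refl = s∈B
  ... | no x≢s   = proj₁ (∈-filter⁻ (∁? (_≟ s)) (to (∈-filter⁺ (∁? (_≟ s)) x∈A x≢s)))

Simple-map-without : ∀ {s L} → All (s ∈_) L → Simple L → Simple (map (without s) L)
Simple-map-without [] [] = []
Simple-map-without (s∈E ∷ s∈L) (E≉L ∷ simple) =
  AllP.map⁺ (All.zipWith (λ (s∈E′ , E≉E′) → E≉E′ ∘ ≐-without⁻ s∈E s∈E′) (s∈L , E≉L)) ∷
  Simple-map-without s∈L simple

Simple-⊆⇒length≤2^ : ∀ S L → Simple L → All (_⊆ S) L → length L ≤ 2 ^ length S
Simple-⊆⇒length≤2^ [] [] _ _ = z≤n
Simple-⊆⇒length≤2^ [] (E ∷ []) _ _ = s≤s z≤n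
Simple-⊆⇒length≤2^ [] (E ∷ E′ ∷ L) ((E≉E′ ∷ _) ∷ _) (E⊆[] ∷ E′⊆[] ∷ _) =
  contradiction (λ x → (λ x∈ → contradiction (E⊆[] x∈) λ ()) , (λ x∈ → contradiction (E′⊆[] x∈) λ ()))
                E≉E′
Simple-⊆⇒length≤2^ (s ∷ S) L simple L⊆s∷S = begin
  length L                                                 ≡⟨ length-filter-∁ (s ∈?_) L ⟨
  length (filter (s ∈?_) L) + length (filter (∁? (s ∈?_)) L) ≤⟨ +-mono-≤ with-s without-s ⟩
  2 ^ length S + 2 ^ length S                              ≡⟨ cong (2 ^ length S +_) (+-identityʳ _) ⟨
  2 ^ length (s ∷ S)                                       ∎
  where
  open ≤-Reasoning
  with-s : length (filter (s ∈?_) L) ≤ 2 ^ length S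
  with-s = subst (_≤ 2 ^ length S) (length-map (without s) (filter (s ∈?_) L))
    (Simple-⊆⇒length≤2^ S (map (without s) (filter (s ∈?_) L))
      (Simple-map-without (AllP.all-filter (s ∈?_) L) (AP.filter⁺ (s ∈?_) simple))
      (AllP.map⁺ (All.tabulate λ E∈ x∈ →
        let x∈E , x≢s = ∈-filter⁻ (∁? (_≟ s)) x∈ in
        Any.tail x≢s (All.lookup L⊆s∷S (proj₁ (∈-filter⁻ (s ∈?_) E∈)) x∈E))))
  without-s : length (filter (∁? (s ∈?_)) L) ≤ 2 ^ length S
  without-s = Simple-⊆⇒length≤2^ S (filter (∁? (s ∈?_)) L) (AP.filter⁺ (∁? (s ∈?_)) simple)
    (All.tabulate λ E∈ x∈E →
      let E∈L , s∉E = ∈-filter⁻ (∁? (s ∈?_)) E∈ in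
      Any.tail (λ { refl → s∉E x∈E }) (All.lookup L⊆s∷S E∈L x∈E))

deg : Hypergraph → ℕ → ℕ
deg H x = length (filter (x ∈?_) H)

Simple⇒Unique : ∀ {L} → Simple L → Unique L
Simple⇒Unique = AllPairs.map (λ E≉E′ → λ { refl → E≉E′ λ _ → (λ x∈ → x∈) , (λ x∈ → x∈) })

record FreshEdge (H : Hypergraph) (z : ℕ) (S : List ℕ) {m} (used : Fin m → Fin (length H)) : Set where
  constructor freshEdge
  field
    edge     : Fin (length H)
    unused   : ∀ k → used k ≢ edge
    z∈edge   : z ∈ lookup H edge
    new      : ℕ
    new∈edge : new ∈ lookup H edge
    new∉S    : new ∉ S

insideOrListed-length≤ : ∀ S (L : List Edge) {G} → Simple G →
                  length (filter ((_⊆? S) ∪? (_∈ₑ? L)) G) ≤ 2 ^ length S + length L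
insideOrListed-length≤ S L {G} simple = ≤-trans (length-filter-∪ (_⊆? S) (_∈ₑ? L) G) (+-mono-≤ inside listed)
  where
  inside : length (filter (_⊆? S) G) ≤ 2 ^ length S
  inside = Simple-⊆⇒length≤2^ S _ (AP.filter⁺ (_⊆? S) simple) (AllP.all-filter (_⊆? S) G)
  listed : length (filter (_∈ₑ? L) G) ≤ length L
  listed = Unique-⊆⇒length≤ (≡-dec _≟_) (AP.filter⁺ (_∈ₑ? L) (Simple⇒Unique simple))
                            (proj₂ ∘ ∈-filter⁻ (_∈ₑ? L) {xs = G})

findFreshEdge : ∀ {H z S m} → Simple H → (used : Fin m → Fin (length H)) → 2 ^ length S + m < deg H z →
                FreshEdge H z S used
findFreshEdge {H} {z} {S} simple used deg>
  with E , E∈through , E∉ ← find (filter-shorter⇒Any∁ ((_⊆? S) ∪? (_∈ₑ? tabulate (lookup H ∘ used)))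
         (≤-<-trans (insideOrListed-length≤ S (tabulate (lookup H ∘ used)) (AP.filter⁺ (z ∈?_) simple))
                    (subst (λ m → 2 ^ length S + m < deg H z) (sym (length-tabulate (lookup H ∘ used))) deg>)))
  with E∈H , z∈E ← ∈-filter⁻ (z ∈?_) {xs = H} E∈through
  with new , new∈E , new∉S ← find (¬All⇒Any¬ (_∈? S) E (E∉ ∘ inj₁ ∘ All.lookup))
  = freshEdge (Any.index E∈H) unused (atIndex z∈E) new (atIndex new∈E) new∉S
  where
  atIndex : ∀ {x} → x ∈ E → x ∈ lookup H (Any.index E∈H)
  atIndex = subst (_ ∈_) (lookup-index E∈H)
  unused : ∀ k → used k ≢ Any.index E∈H
  unused k eq = E∉ (inj₂ (subst (_∈ tabulate (lookup H ∘ used))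
                               (trans (cong (lookup H) eq) (sym (lookup-index E∈H))) (∈-tabulate⁺ k)))

-- Pendant edges of forests

≐-sym : ∀ {E E′} → E ≐ E′ → E′ ≐ E
≐-sym eq x = swap (eq x)

otherEndpoint : ∀ {E x} → IsTwoSet E → x ∈ E → ∃ λ y → y ≢ x × y ∈ E
otherEndpoint (a , b , a≢b , refl) (here refl)         = b , ≢-sym a≢b , there (here refl)
otherEndpoint (a , b , a≢b , refl) (there (here refl)) = a , a≢b , here refl

twoSet-⊆ : ∀ {E x y} → IsTwoSet E → x ≢ y → x ∈ E → y ∈ E → E ⊆ x ∷ y ∷ []
twoSet-⊆ (a , b , _ , refl) x≢y (here refl)         (here refl)         = contradiction refl x≢y
twoSet-⊆ (a , b , _ , refl) _   (here refl)         (there (here refl)) = λ z∈ → z∈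
twoSet-⊆ (a , b , _ , refl) _   (there (here refl)) (here refl)         =
  λ { (here refl) → there (here refl) ; (there (here refl)) → here refl }
twoSet-⊆ (a , b , _ , refl) x≢y (there (here refl)) (there (here refl)) = contradiction refl x≢y

pair-⊆ : ∀ {x y} {B : List ℕ} → x ∈ B → y ∈ B → x ∷ y ∷ [] ⊆ B
pair-⊆ x∈ y∈ (here refl)         = x∈
pair-⊆ x∈ y∈ (there (here refl)) = y∈

twoSet-≐ : ∀ {E E′ x y} → IsTwoSet E → IsTwoSet E′ → x ≢ y →
           x ∈ E → y ∈ E → x ∈ E′ → y ∈ E′ → E ≐ E′
twoSet-≐ two two′ x≢y x∈E y∈E x∈E′ y∈E′ z =
  (λ z∈ → pair-⊆ x∈E′ y∈E′ (twoSet-⊆ two x≢y x∈E y∈E z∈)) ,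
  (λ z∈ → pair-⊆ x∈E y∈E (twoSet-⊆ two′ x≢y x∈E′ y∈E′ z∈))

module _ {G G′ : Hypergraph} (G⊆G′ : G ⊆ G′) where

  CycAdj-mono : ∀ first C → CycAdj G first C → CycAdj G′ first C
  CycAdj-mono first (x ∷ [])     (E , E∈ , rest)       = E , G⊆G′ E∈ , rest
  CycAdj-mono first (x ∷ y ∷ zs) ((E , E∈ , rest) , c) = (E , G⊆G′ E∈ , rest) , CycAdj-mono first (y ∷ zs) c

  IsCycle-mono : ∀ C → IsCycle G C → IsCycle G′ C
  IsCycle-mono C@(x ∷ _ ∷ _ ∷ _) (distinct , c) = distinct , CycAdj-mono x C c

removeAt-IsForest : ∀ F i → IsForest F → IsForest (removeAt F i)
removeAt-IsForest F i ((twoSets , simple) , acyclic) =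
  (All.tabulate (All.lookup twoSets ∘ ∈-removeAt⁻ F i) , AllPairs-removeAt⁺ i simple) ,
  λ C → acyclic C ∘ IsCycle-mono (∈-removeAt⁻ F i) C

CycAdj-take : ∀ {G first q xs} (q∈ : q ∈ xs) → Linked (Adjacent G) xs → Adjacent G q first →
              CycAdj G first (take (suc (toℕ (Any.index q∈))) xs)
CycAdj-take (here refl) _ q~first = q~first
CycAdj-take {xs = _ ∷ _ ∷ _} (there q∈) (x~y ∷ linked) q~first = x~y , CycAdj-take q∈ linked q~first

cycleThrough : ∀ {G p p′ q xs} → q ∈ xs → Unique (p ∷ p′ ∷ xs) → Linked (Adjacent G) (p ∷ p′ ∷ xs) →
               Adjacent G q p → ∃ (IsCycle G)
cycleThrough {xs = _ ∷ _} q∈ distinct linked q~p =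
  _ , AP.take⁺ (3 + toℕ (Any.index q∈)) distinct , CycAdj-take (there (there q∈)) linked q~p

adjacentAt : ∀ {G} j {x y} → x ∈ lookup G j → y ∈ lookup G j → x ≢ y → Adjacent G x y
adjacentAt {G} j x∈ y∈ x≢y = lookup G j , ∈-lookup j , x∈ , y∈ , x≢y

NoPendantEdge : Hypergraph → Set
NoPendantEdge G = ∀ i {x} → x ∈ lookup G i → x ∈ vertices (removeAt G i)

module _ {G : Hypergraph} (graph : IsSimpleGraph G) (noPendant : NoPendantEdge G) where

  private
    twoSet : ∀ {E} → E ∈ G → IsTwoSet E
    twoSet = All.lookup (proj₁ graph)

  continueAt : ∀ i {x y} → x ∈ lookup G i → y ∈ lookup G i → x ≢ y →
               ∃ λ z → z ≢ x × z ≢ y × ∃ λ j → z ∈ lookup G j × x ∈ lookup G j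
  continueAt i {x} {y} x∈ y∈ x≢y
    with E , x∈E , E∈G∖i ← ∈-concat⁻′ (removeAt G i) (noPendant i x∈)
    with z , z≢x , z∈E ← otherEndpoint (twoSet (∈-removeAt⁻ G i E∈G∖i)) x∈E
    = z , z≢x , z≢y , Any.index E∈G , subst (z ∈_) (lookup-index E∈G) z∈E ,
      subst (x ∈_) (lookup-index E∈G) x∈E
    where
    E∈G : E ∈ G
    E∈G = ∈-removeAt⁻ G i E∈G∖i
    z≢y : z ≢ y
    z≢y refl = AllPairs-lookup-removeAt (λ E≉E′ → E≉E′ ∘ ≐-sym) i (proj₂ graph) E∈G∖i
                 (twoSet-≐ (twoSet (∈-lookup i)) (twoSet E∈G) x≢y x∈ y∈ x∈E z∈E)

  record Trail : Set where
    constructor trail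
    field
      x₀ x₁    : ℕ
      xs       : List ℕ
      distinct : Unique (x₀ ∷ x₁ ∷ xs)
      linked   : Linked (Adjacent G) (x₀ ∷ x₁ ∷ xs)
      edge     : Fin (length G)
      x₀∈edge  : x₀ ∈ lookup G edge
      x₁∈edge  : x₁ ∈ lookup G edge
      onG      : x₀ ∷ x₁ ∷ xs ⊆ vertices G

  firstTrail : Fin (length G) → Trail
  firstTrail i with a , b , a≢b , Gi≡ab ← twoSet (∈-lookup i) =
    trail a b [] ((a≢b ∷ []) ∷ [] ∷ []) (adjacentAt i a∈ b∈ a≢b ∷ [-]) i a∈ b∈ onG
    where
    a∈ : a ∈ lookup G i
    a∈ = subst (a ∈_) (sym Gi≡ab) (here refl)
    b∈ : b ∈ lookup G i
    b∈ = subst (b ∈_) (sym Gi≡ab) (there (here refl))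
    onG : a ∷ b ∷ [] ⊆ vertices G
    onG = pair-⊆ (∈-vertices⁺ G i a∈) (∈-vertices⁺ G i b∈)

  extendTrail : (t : Trail) → ∃ (IsCycle G) ⊎ ∃ λ t′ → length (Trail.xs t) < length (Trail.xs t′)
  extendTrail (trail x₀ x₁ xs distinct linked i x₀∈ x₁∈ onG)
    with z , z≢x₀ , z≢x₁ , j , z∈ , x₀∈′ ← continueAt i x₀∈ x₁∈ (All.head (AllPairs.head distinct))
    with z ∈? xs
  ... | yes z∈xs = inj₁ (cycleThrough z∈xs distinct linked (adjacentAt j z∈ x₀∈′ z≢x₀))
  ... | no z∉xs  =
    inj₂ (trail z x₀ (x₁ ∷ xs) distinct′ (adjacentAt j z∈ x₀∈′ z≢x₀ ∷ linked) j z∈ x₀∈′ onG′ ,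
          ≤-refl)
    where
    distinct′ : Unique (z ∷ x₀ ∷ x₁ ∷ xs)
    distinct′ = (z≢x₀ ∷ z≢x₁ ∷ AllP.¬Any⇒All¬ xs z∉xs) ∷ distinct
    onG′ : z ∷ x₀ ∷ x₁ ∷ xs ⊆ vertices G
    onG′ (here refl) = ∈-vertices⁺ G j z∈
    onG′ (there v∈)  = onG v∈

  trailOfLength : Fin (length G) → ∀ n → ∃ (IsCycle G) ⊎ ∃ λ t → n ≤ length (Trail.xs t)
  trailOfLength i zero = inj₂ (firstTrail i , z≤n)
  trailOfLength i (suc n) with trailOfLength i n
  ... | inj₁ cycle = inj₁ cycle
  ... | inj₂ (t , n≤) with extendTrail t
  ...   | inj₁ cycle         = inj₁ cycle
  ...   | inj₂ (t′ , longer) = inj₂ (t′ , ≤-trans (s≤s n≤) longer)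

  noPendantEdge⇒cycle : Fin (length G) → ∃ (IsCycle G)
  noPendantEdge⇒cycle i with trailOfLength i (length (vertices G))
  ... | inj₁ cycle = cycle
  ... | inj₂ (trail _ _ xs distinct _ _ _ _ onG , long) =
    contradiction (Unique-⊆⇒length≤ _≟_ distinct onG) (<⇒≱ (≤-trans (s≤s long) (n≤1+n _)))

record PendantEdge (F : Hypergraph) : Set where
  field
    pos          : Fin (length F)
    leaf parent  : ℕ
    leaf≢parent  : leaf ≢ parent
    leaf∈        : leaf ∈ lookup F pos
    ⊆leafParent  : lookup F pos ⊆ leaf ∷ parent ∷ []
    leaf∉removed : leaf ∉ vertices (removeAt F pos)

pendantEdge : ∀ F → IsForest F → Fin (length F) → PendantEdge F
pendantEdge F (graph , acyclic) i₀
  with FinP.any? (λ i → Any.any? (λ x → x ∉? vertices (removeAt F i)) (lookup F i))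
... | yes (i , pendant)
  with x , x∈ , x∉ ← find pendant
  with two ← All.lookup (proj₁ graph) (∈-lookup i)
  with y , y≢x , y∈ ← otherEndpoint two x∈ =
  record { pos = i ; leaf = x ; parent = y ; leaf≢parent = ≢-sym y≢x ; leaf∈ = x∈
         ; ⊆leafParent = twoSet-⊆ two (≢-sym y≢x) x∈ y∈ ; leaf∉removed = x∉ }
... | no none = contradiction (proj₂ cycle) (acyclic (proj₁ cycle))
  where
  noPendant : NoPendantEdge F
  noPendant i {x} x∈ = decidable-stable (x ∈? vertices (removeAt F i)) (λ x∉ → none (i , lose x∈ x∉))
  cycle : ∃ (IsCycle F)
  cycle = noPendantEdge⇒cycle graph noPendant i₀

length-parent∷removed : ∀ {F} (P : PendantEdge F) → let open PendantEdge P in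
                        length (parent ∷ vertices (removeAt F pos)) ≤ length (vertices F)
length-parent∷removed {F} P = ≤-trans (+-monoˡ-≤ (length (vertices (removeAt F pos))) (∈-length leaf∈))
                                      (≤-reflexive (sym (length-concat-removeAt F pos)))
  where open PendantEdge P

-- Embedding forests into hypergraphs of large minimum degree

module _ {H : Hypergraph} (simple : Simple H) {T K : ℕ}
         (rich : ∀ x → x ∈ vertices H → 2 ^ T + K < deg H x) where

  freshEdgeAt : ∀ {x S m} → x ∈ vertices H → length S ≤ T → m ≤ K → (used : Fin m → Fin (length H)) →
                FreshEdge H x S used
  freshEdgeAt x∈ |S|≤T m≤K used =
    findFreshEdge simple used (≤-<-trans (+-mono-≤ (^-monoʳ-≤ 2 |S|≤T) m≤K) (rich _ x∈))

  module _ {a₀ : ℕ} (a₀∈ : a₀ ∈ vertices H) where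

    placeVertex : ∀ {φ A} x → InjectiveOn φ A → (∀ z → z ∈ A → φ z ∈ vertices H) → length A ≤ T →
                  ∃ λ ψ → InjectiveOn ψ (x ∷ A) × (∀ z → z ∈ A → ψ z ≡ φ z) × ψ x ∈ vertices H
    placeVertex {φ} {A} x φ-inj φ-vert |A|≤T with x ∈? A
    ... | yes x∈A =
      φ , InjectiveOn-⊆ (λ { (here refl) → x∈A ; (there z∈A) → z∈A }) φ-inj , (λ _ _ → refl) , φ-vert x x∈A
    ... | no x∉A =
      φ [ x ↦ new ] , InjectiveOn-[↦] φ-inj x∉A new∉S , (λ _ z∈A → [↦]-unchanged φ λ { refl → x∉A z∈A }) ,
      subst (_∈ vertices H) (sym ([↦]-updated φ x new)) (∈-vertices⁺ H edge new∈edge)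
      where
      -- Any vertex outside φ A will do; a fresh edge at a₀ with nothing used provides one.
      open FreshEdge (freshEdgeAt {S = map φ A} a₀∈ (subst (_≤ T) (sym (length-map φ A)) |A|≤T) z≤n (λ ()))

    extendAlongPendant : ∀ F (P : PendantEdge F) → length (vertices F) ≤ T → length F ≤ K →
                         Contains H (removeAt F (PendantEdge.pos P)) → Contains H F
    extendAlongPendant F P |V|≤T |F|≤K (φ , f , φ-inj , φ-vert , f-inj , φ-edges)
      with |parent∷rest|≤T ← ≤-trans (length-parent∷removed P) |V|≤T
      with ψ , ψ-inj , ψ≗φ , ψ-parent∈ ←
             placeVertex (PendantEdge.parent P) φ-inj φ-vert (≤-trans (n≤1+n _) |parent∷rest|≤T) =
      φ′ , f′ , InjectiveOn-⊆ V⊆ (InjectiveOn-[↦] ψ-inj leaf∉ new∉S) , edges⇒vertices F H f′ φ′-edges ,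
      extendAt-injective F pos f edge f-inj unused , φ′-edges
      where
      open PendantEdge P
      rest : List ℕ
      rest = vertices (removeAt F pos)

      open FreshEdge (freshEdgeAt {S = map ψ (parent ∷ rest)} ψ-parent∈
                                  (subst (_≤ T) (sym (length-map ψ (parent ∷ rest))) |parent∷rest|≤T)
                                  (≤-trans (length-removeAt≤ F pos) |F|≤K) f)

      φ′ : ℕ → ℕ
      φ′ = ψ [ leaf ↦ new ]
      f′ : Fin (length F) → Fin (length H)
      f′ = extendAt F pos f edge

      leaf∉ : leaf ∉ parent ∷ rest
      leaf∉ (here leaf≡parent) = leaf≢parent leaf≡parent
      leaf∉ (there leaf∈rest)  = leaf∉removed leaf∈rest

      V⊆ : vertices F ⊆ leaf ∷ parent ∷ rest
      V⊆ z∈ with ∈-++⁻ (lookup F pos) (∈-resp-↭ (concat-removeAt F pos) z∈)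
      ... | inj₁ z∈pos  = pair-⊆ (here refl) (there (here refl)) (⊆leafParent z∈pos)
      ... | inj₂ z∈rest = there (there z∈rest)

      edgesAt : ∀ {k} (v : RemoveAtView F pos k) z → z ∈ lookup F k →
                φ′ z ∈ lookup H (extendAtView F pos f edge v)
      edgesAt removed z z∈ with ⊆leafParent z∈
      ... | here refl         = subst (_∈ lookup H edge) (sym ([↦]-updated ψ leaf new)) new∈edge
      ... | there (here refl) = subst (_∈ lookup H edge) (sym ([↦]-unchanged ψ (≢-sym leaf≢parent))) z∈edge
      edgesAt (kept k) z z∈ =
        subst (_∈ lookup H (f k))
              (sym (trans ([↦]-unchanged ψ λ { refl → leaf∉removed z∈rest }) (ψ≗φ z z∈rest)))
              (φ-edges k z z∈k)
        where
        z∈k : z ∈ lookup (removeAt F pos) k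
        z∈k = subst (z ∈_) (sym (lookup-removeAt F pos k)) z∈
        z∈rest : z ∈ rest
        z∈rest = ∈-vertices⁺ (removeAt F pos) k z∈k

      φ′-edges : ∀ k z → z ∈ lookup F k → φ′ z ∈ lookup H (f′ k)
      φ′-edges k = edgesAt (removeAtView F pos k)

    embedForest : ∀ n F → length F ≡ n → IsForest F → length (vertices F) ≤ T → length F ≤ K → Contains H F
    embedForest zero    []        _    _      _     _    = Contains-[] H
    embedForest (suc n) F@(_ ∷ _) |F|≡ forest |V|≤T |F|≤K =
      extendAlongPendant F P |V|≤T |F|≤K
        (embedForest n (removeAt F pos) (trans (length-removeAt F pos) (cong pred |F|≡))
                     (removeAt-IsForest F pos forest)
                     (≤-trans (≤-trans (n≤1+n _) (length-parent∷removed P)) |V|≤T)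
                     (≤-trans (length-removeAt≤ F pos) |F|≤K))
      where
      P : PendantEdge F
      P = pendantEdge F forest zero
      open PendantEdge P

-- length (vertices F) counts vertices with multiplicity; only an upper bound on v F is needed.
threshold : Hypergraph → ℕ
threshold F = 2 ^ length (vertices F) + length F

module _ (F : Hypergraph) (forest : IsForest F) where

  lowDegreeVertex : ∀ {H a₀} → Simple H → ¬ Contains H F → a₀ ∈ vertices H →
                    ∃ λ x → x ∈ vertices H × deg H x ≤ threshold F
  lowDegreeVertex {H} simple ¬F a₀∈ with Any.any? (λ x → deg H x ≤? threshold F) (vertices H)
  ... | yes low = find low
  ... | no ¬low = contradiction (embedForest simple rich a₀∈ _ F refl forest ≤-refl ≤-refl) ¬F
    where
    rich : ∀ x → x ∈ vertices H → threshold F < deg H x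
    rich x x∈ = ≰⇒> (¬low ∘ lose x∈)

  edgeBound : ∀ n {V} H → length V ≤ n → vertices H ⊆ V → IsHypergraph H → Simple H → ¬ Contains H F →
              e H ≤ threshold F * n
  edgeBound n [] _ _ _ _ _ = z≤n
  edgeBound n ([] ∷ _) _ _ ([]≢[] ∷ _) _ _ = contradiction refl []≢[]
  edgeBound n {V} H@((_ ∷ _) ∷ _) |V|≤n H⊆V hyp simple ¬F
    with x , x∈H , deg≤ ← lowDegreeVertex simple ¬F (here refl) = peel n |V|≤n (H⊆V x∈H)
    where
    H′ : Hypergraph
    H′ = filter (∁? (x ∈?_)) H
    V′ : List ℕ
    V′ = filter (∁? (_≟ x)) V
    H′⊆V′ : vertices H′ ⊆ V′
    H′⊆V′ z∈ with E , z∈E , E∈H′ ← ∈-concat⁻′ H′ z∈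
             with E∈H , x∉E ← ∈-filter⁻ (∁? (x ∈?_)) {xs = H} E∈H′ =
      ∈-filter⁺ (∁? (_≟ x)) (H⊆V (∈-concat⁺′ z∈E E∈H)) λ { refl → x∉E z∈E }

    peel : ∀ n → length V ≤ n → x ∈ V → e H ≤ threshold F * n
    peel zero    |V|≤0 x∈V = contradiction (∈-length x∈V) (≤⇒≯ |V|≤0)
    peel (suc n) |V|≤n x∈V = begin
      e H                           ≡⟨ length-filter-∁ (x ∈?_) H ⟨
      deg H x + e H′                ≤⟨ +-mono-≤ deg≤ (edgeBound n H′ |V′|≤n H′⊆V′ hyp′ simple′ ¬F′) ⟩
      threshold F + threshold F * n ≡⟨ *-suc (threshold F) n ⟨
      threshold F * suc n           ∎
      where
      open ≤-Reasoning
      |V′|≤n : length V′ ≤ n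
      |V′|≤n = ≤-pred (≤-trans (filter-notAll (∁? (_≟ x)) V (lose x∈V λ x≢x → x≢x refl)) |V|≤n)
      hyp′ : IsHypergraph H′
      hyp′ = All.tabulate (All.lookup hyp ∘ proj₁ ∘ ∈-filter⁻ (∁? (x ∈?_)) {xs = H})
      simple′ : Simple H′
      simple′ = AP.filter⁺ (∁? (x ∈?_)) simple
      ¬F′ : ¬ Contains H′ F
      ¬F′ = ¬F ∘ Contains-filter⁻ (∁? (x ∈?_)) H {F}

theorem4 : (F : Hypergraph) → IsForest F →
    ∃ λ (c : ℕ) → ∃ λ (N : ℕ) → ∀ (n : ℕ) → N ≤ n →
    ∀ (H : Hypergraph) → IsHypergraph H → Simple H → v H ≤ n →
    ¬ Contains H F → e H < c * n
theorem4 F forest = suc (threshold F) , 1 , λ n 1≤n H hyp simple |V|≤n ¬F → begin-strict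
  e H                     ≤⟨ edgeBound F forest (v H) H ≤-refl (∈-deduplicate⁺ _≟_) hyp simple ¬F ⟩
  threshold F * v H       ≤⟨ *-monoʳ-≤ (threshold F) |V|≤n ⟩
  threshold F * n         <⟨ m<n+m (threshold F * n) 1≤n ⟩
  suc (threshold F) * n   ∎
  where open ≤-Reasoning
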